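{- Let $G$ be a connected countable graph. If $G$ is compact with respect to its graph convergence, then $G$ has a spanning tree containing no ray.
   Context: Graphs are simple and undirected; $N[v]$ is the closed neighbourhood of $v$. A net is a function $\varphi\colon\mathbb{D}\to V(G)$ from a directed set, with induced filter $\varphi^\uparrow$ (sets containing some tail $\{\varphi_b:b\ge d\}$); $\psi$ is a subnet of $\varphi$ if $\varphi^\uparrow\subseteq\psi^\uparrow$. Graph convergence: $\varphi\to v$ iff $N[v]\in\varphi^\uparrow$. $G$ is compact if every net in $V(G)$ has a convergent subnet. A ray is a sequence of distinct vertices $\langle v_n\rangle_{n\in\mathbb{N}}$ with $v_nv_{n+1}$ an edge for all $n$. -}

module Defs where

open import Level using (0ℓ)
open import Data.Nat using (ℕ; zero; suc)
open import Data.Fin using (Fin; inject₁; fromℕ) renaming (zero to fzero; suc to fsuc)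
open import Data.Product using (Σ; ∃; ∃-syntax; _×_; _,_)
open import Data.Sum using (_⊎_)
open import Data.Empty using (⊥)
open import Relation.Nullary using (¬_)
open import Relation.Binary.PropositionalEquality using (_≡_)
open import Relation.Binary.Construct.Closure.ReflexiveTransitive using (Star)
open import Function.Definitions using (Injective)

record Graph : Set₁ where
  field
    V      : Set
    E      : V → V → Set
    E-prop : ∀ {u v} (p q : E u v) → p ≡ q
    E-sym  : ∀ {u v} → E u v → E v u
    E-irr  : ∀ {v} → ¬ E v v

module _ (G : Graph) where
  open Graph G

  Countable : Set
  Countable = Σ (V → ℕ) (Injective _≡_ _≡_)

  -- connected: non-empty and any two vertices are joined by a walk
  Connected : Set
  Connected = V × (∀ u v → Star E u v)

  N[_] : V → V → Set
  N[ v ] u = (u ≡ v) ⊎ E v u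

record DirectedSet : Set₁ where
  field
    D        : Set
    _≤_      : D → D → Set
    ≤-refl   : ∀ {a} → a ≤ a
    ≤-trans  : ∀ {a b c} → a ≤ b → b ≤ c → a ≤ c
    inhabited : D
    directed : ∀ a b → ∃[ c ] (a ≤ c × b ≤ c)

open DirectedSet

Net : DirectedSet → Set → Set
Net 𝔻 X = D 𝔻 → X

-- induced filter: A ∈ φ↑ iff A contains some tail {φ b : b ≥ d}
InFilter : {X : Set} (𝔻 : DirectedSet) → (X → Set) → Net 𝔻 X → Set
InFilter 𝔻 A φ = ∃[ d ] (∀ b → _≤_ 𝔻 d b → A (φ b))

-- ψ is a subnet of φ iff φ↑ ⊆ ψ↑
IsSubnet : {X : Set} (𝔼 𝔻 : DirectedSet) → Net 𝔼 X → Net 𝔻 X → Set₁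
IsSubnet {X} 𝔼 𝔻 ψ φ = (A : X → Set) → InFilter 𝔻 A φ → InFilter 𝔼 A ψ

module _ (G : Graph) where
  open Graph G

  -- graph convergence: φ → v iff N[v] ∈ φ↑
  ConvergesTo : (𝔻 : DirectedSet) → Net 𝔻 V → V → Set
  ConvergesTo 𝔻 φ v = InFilter 𝔻 (N[ G ] v) φ

  Compact : Set₁
  Compact = (𝔻 : DirectedSet) (φ : Net 𝔻 V) →
            Σ DirectedSet λ 𝔼 → Σ (Net 𝔼 V) λ ψ →
              IsSubnet 𝔼 𝔻 ψ φ × ∃[ v ] ConvergesTo 𝔼 ψ v

module _ {V : Set} (T : V → V → Set) where

  -- a cycle of length k+3 ≥ 3: distinct vertices c₀,…,c_{k+2},
  -- consecutive ones adjacent and c_{k+2} adjacent to c₀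
  record Cycle : Set where
    field
      len  : ℕ
      c    : Fin (suc (suc (suc len))) → V
      c-inj : Injective _≡_ _≡_ c
      c-adj : ∀ (i : Fin (suc (suc len))) → T (c (inject₁ i)) (c (fsuc i))
      c-close : T (c (fromℕ (suc (suc len)))) (c fzero)

  Acyclic : Set
  Acyclic = ¬ Cycle

  record Ray : Set where
    field
      r     : ℕ → V
      r-inj : Injective _≡_ _≡_ r
      r-adj : ∀ n → T (r n) (r (suc n))

module _ (G : Graph) where
  open Graph G

  record SpanningTree : Set₁ where
    field
      T      : V → V → Set
      T-prop : ∀ {u v} (p q : T u v) → p ≡ q
      T-sym  : ∀ {u v} → T u v → T v u
      T⊆E    : ∀ {u v} → T u v → E u v
      T-conn : ∀ u v → Star T u v
      T-acyc : Acyclic T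

  RayFree : SpanningTree → Set
  RayFree S = ¬ Ray (SpanningTree.T S)

{-# OPTIONS --safe #-}
-- Compactness forces finitely many vertices to dominate G: otherwise a sequence of
-- undominated vertices eventually leaves every closed neighbourhood, so no subnet of
-- it converges. Hence breadth-first depth from a root is bounded, and the tree of
-- breadth-first parent edges has no ray: once a ray steps away from the root it must
-- keep doing so, and its depth grows without bound.
module Submission where

open import Defs
open import Level using (0ℓ)
open import Axiom.ExcludedMiddle using (ExcludedMiddle)
open import Axiom.DoubleNegationElimination using (em⇒dne)
open import Data.Nat using (ℕ; zero; suc; _+_; _≤_; _<_; _⊔_; z≤n; s≤s)
open import Data.Nat.Properties
open import Data.Nat.Induction using (<-wellFounded)
open import Induction.WellFounded using (Acc; acc)
open import Data.Fin using (Fin; inject₁; fromℕ; toℕ) renaming (zero to fzero; suc to fsuc)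
open import Data.Fin.Properties using (toℕ-inject₁)
open import Data.Fin.Relation.Unary.Top using (view; ‵fromℕ; ‵inj₁)
open import Data.List using (allFin)
open import Data.List.Membership.Propositional.Properties using (∈-allFin)
open import Data.List.Extrema.Nat using (argmax; f[xs]≤f[argmax])
import Data.List.Relation.Unary.All as All
open import Data.Product using (Σ; ∃; ∃₂; ∃-syntax; _×_; _,_; proj₁; proj₂)
open import Data.Sum using (_⊎_; inj₁; inj₂)
open import Data.Empty using (⊥; ⊥-elim)
open import Relation.Nullary using (¬_; yes; no)
open import Relation.Binary.Definitions using (Symmetric)
open import Relation.Binary.PropositionalEquality
open import Relation.Binary.Construct.Closure.ReflexiveTransitive using (Star; ε; _◅_; _◅◅_; reverse)
open import Function using (_∘_)
open import Function.Definitions using (Injective)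

module Classical (lem : ExcludedMiddle 0ℓ) where

  ¬∀⇒∃¬ : {A : Set} {P : A → Set} → ¬ (∀ x → P x) → ∃[ x ] ¬ P x
  ¬∀⇒∃¬ {P = P} ¬∀ with lem {∃[ x ] ¬ P x}
  ... | yes ∃¬ = ∃¬
  ... | no ¬∃¬ = ⊥-elim (¬∀ λ x → em⇒dne lem λ ¬Px → ¬∃¬ (x , ¬Px))

  least : {P : ℕ → Set} {n : ℕ} → P n → ∃[ m ] P m × (∀ {k} → P k → m ≤ k)
  least {P} = least-from (<-wellFounded _)
    where
    least-from : ∀ {n} → Acc _<_ n → P n → ∃[ m ] P m × (∀ {k} → P k → m ≤ k)
    least-from {n} (acc below) Pn with lem {∃[ k ] k < n × P k}
    ... | yes (k , k<n , Pk) = least-from (below k<n) Pk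
    ... | no none = n , Pn , λ Pk → ≮⇒≥ λ k<n → none (_ , k<n , Pk)

  bounded-on-code< : {A : Set} (code : A → ℕ) → Injective _≡_ _≡_ code → (f : A → ℕ) →
                     ∀ n → ∃[ B ] (∀ {u} → code u < n → f u ≤ B)
  bounded-on-code< code code-inj f zero = 0 , λ ()
  bounded-on-code< code code-inj f (suc n)
    with bounded-on-code< code code-inj f n | lem {∃[ u ] code u ≡ n}
  ... | B , bounded | yes (u₀ , code-u₀) = B ⊔ f u₀ , bound
    where
    bound : ∀ {u} → code u < suc n → f u ≤ B ⊔ f u₀
    bound lt with m<1+n⇒m<n∨m≡n lt
    ... | inj₁ lt′ = m≤n⇒m≤n⊔o (f u₀) (bounded lt′)
    ... | inj₂ code-u = m≤n⇒m≤o⊔n B (≤-reflexive (cong f (code-inj (trans code-u (sym code-u₀)))))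
  ... | B , bounded | no ∄u = B , bound
    where
    bound : ∀ {u} → code u < suc n → f u ≤ B
    bound lt with m<1+n⇒m<n∨m≡n lt
    ... | inj₁ lt′ = bounded lt′
    ... | inj₂ code-u = ⊥-elim (∄u (_ , code-u))

open Classical

ℕ-directedSet : DirectedSet
ℕ-directedSet = record
  { D = ℕ ; _≤_ = _≤_ ; ≤-refl = ≤-refl ; ≤-trans = ≤-trans ; inhabited = 0
  ; directed = λ a b → a ⊔ b , m≤m⊔n a b , m≤n⊔m a b }

maximum : ∀ {n} (f : Fin (suc n) → ℕ) → ∃[ i ] ∀ j → f j ≤ f i
maximum f = argmax f fzero (allFin _) ,
  λ j → All.lookup (f[xs]≤f[argmax] {f = f} fzero (allFin _)) (∈-allFin j)

module _ {V : Set} {T : V → V → Set} (T-sym : Symmetric T) (C : Cycle T) where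
  open Cycle C

  cycle-neighbours : ∀ i → ∃₂ λ j k → j ≢ k × T (c i) (c j) × T (c i) (c k)
  cycle-neighbours fzero = fsuc fzero , fromℕ _ , (λ ()) , c-adj fzero , T-sym c-close
  cycle-neighbours (fsuc i) with view i
  ... | ‵fromℕ = inject₁ i , fzero , (λ ()) , T-sym (c-adj i) , c-close
  ... | ‵inj₁ {i = j} _ = inject₁ i , fsuc (fsuc j) , inject₁²≢suc² , T-sym (c-adj i) , c-adj (fsuc j)
    where
    inject₁²≢suc² : inject₁ (inject₁ j) ≢ fsuc (fsuc j)
    inject₁²≢suc² eq = m≢1+n+m (toℕ j)
      (trans (sym (trans (toℕ-inject₁ (inject₁ j)) (toℕ-inject₁ j))) (cong toℕ eq))

module _ (G : Graph) where
  open Graph G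

  compact⇒¬eventuallyAvoiding : Compact G → (𝔻 : DirectedSet) (φ : Net 𝔻 V) →
                                ¬ (∀ v → InFilter 𝔻 (λ x → ¬ N[ G ] v x) φ)
  compact⇒¬eventuallyAvoiding compact 𝔻 φ avoids with compact 𝔻 φ
  ... | 𝔼 , ψ , subnet , v , (e₁ , near) with subnet (λ x → ¬ N[ G ] v x) (avoids v)
  ... | e₂ , far with DirectedSet.directed 𝔼 e₁ e₂
  ... | e , e₁≤e , e₂≤e = far e e₂≤e (near e e₁≤e)

  DominatedBelow : (V → ℕ) → ℕ → Set
  DominatedBelow code n = ∀ w → ∃[ u ] code u < n × N[ G ] u w

  compact⇒finitelyDominated : ExcludedMiddle 0ℓ → Compact G → (code : V → ℕ) →
                              ∃ (DominatedBelow code)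
  compact⇒finitelyDominated lem compact code = em⇒dne lem λ ¬dominated →
    compact⇒¬eventuallyAvoiding compact ℕ-directedSet _ (avoids ¬dominated)
    where
    module _ (¬dominated : ¬ ∃ (DominatedBelow code)) where
      undominated : ∀ n → ∃[ w ] ¬ (∃[ u ] code u < n × N[ G ] u w)
      undominated n = ¬∀⇒∃¬ lem λ dominated → ¬dominated (n , dominated)

      avoids : ∀ v → InFilter ℕ-directedSet (λ x → ¬ N[ G ] v x) (proj₁ ∘ undominated)
      avoids v = suc (code v) , λ n code<n v~φn → proj₂ (undominated n) (v , code<n , v~φn)

  data Walk : ℕ → V → V → Set where
    []  : ∀ {v} → Walk 0 v v
    _∷_ : ∀ {n u v w} → E u v → Walk n v w → Walk (suc n) u w

  star⇒walk : ∀ {u v} → Star E u v → ∃[ n ] Walk n u v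
  star⇒walk ε = 0 , []
  star⇒walk (e ◅ es) = let n , walk = star⇒walk es in suc n , e ∷ walk

  module BreadthFirst (lem : ExcludedMiddle 0ℓ) (root : V) (reach : ∀ v → Star E v root) where

    private
      shortest : ∀ v → ∃[ n ] Walk n v root × (∀ {k} → Walk k v root → n ≤ k)
      shortest v = least lem (proj₂ (star⇒walk (reach v)))

    depth : V → ℕ
    depth v = proj₁ (shortest v)

    geodesic : ∀ v → Walk (depth v) v root
    geodesic v = proj₁ (proj₂ (shortest v))

    depth-minimal : ∀ {k v} → Walk k v root → depth v ≤ k
    depth-minimal {v = v} = proj₂ (proj₂ (shortest v))

    depth-N : ∀ {u w} → N[ G ] u w → depth w ≤ suc (depth u)
    depth-N (inj₁ refl) = n≤1+n _
    depth-N {u} (inj₂ e) = depth-minimal (E-sym e ∷ geodesic u)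

    depth-zero : ∀ {v} → depth v ≡ 0 → v ≡ root
    depth-zero {v} depth≡0 with depth v | geodesic v
    depth-zero refl | _ | [] = refl

    private
      second : ∀ {n v} → Walk n v root → V
      second {v = v} [] = v
      second (_∷_ {v = u} _ _) = u

      second-step : ∀ {n v} (walk : Walk n v root) → 0 < n →
                    E v (second walk) × depth (second walk) < n
      second-step (e ∷ walk) _ = e , s≤s (depth-minimal walk)

    parent : V → V
    parent v = second (geodesic v)

    parent-adj : ∀ {v} → 0 < depth v → E v (parent v)
    parent-adj {v} = proj₁ ∘ second-step (geodesic v)

    parent-depth : ∀ {v} → 0 < depth v → depth (parent v) < depth v
    parent-depth {v} = proj₂ ∘ second-step (geodesic v)

  module ParentTree (code : V → ℕ) (code-inj : Injective _≡_ _≡_ code)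
                    (root : V) (depth : V → ℕ) (parent : V → V)
                    (depth-zero : ∀ {v} → depth v ≡ 0 → v ≡ root)
                    (parent-adj : ∀ {v} → 0 < depth v → E v (parent v))
                    (parent-depth : ∀ {v} → 0 < depth v → depth (parent v) < depth v) where

    -- Codes are compared instead of vertices so that the edge predicate is
    -- proposition-valued without knowing that V is a set.
    ParentEdge : V → V → Set
    ParentEdge a b = code (parent a) ≡ code b × depth b < depth a

    TreeEdge : V → V → Set
    TreeEdge a b = ParentEdge a b ⊎ ParentEdge b a

    ParentEdge-prop : ∀ {a b} (x y : ParentEdge a b) → x ≡ y
    ParentEdge-prop (x₁ , x₂) (y₁ , y₂) = cong₂ _,_ (≡-irrelevant x₁ y₁) (<-irrelevant x₂ y₂)

    TreeEdge-prop : ∀ {a b} (x y : TreeEdge a b) → x ≡ y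
    TreeEdge-prop (inj₁ x) (inj₁ y) = cong inj₁ (ParentEdge-prop x y)
    TreeEdge-prop (inj₂ x) (inj₂ y) = cong inj₂ (ParentEdge-prop x y)
    TreeEdge-prop (inj₁ (_ , lt₁)) (inj₂ (_ , lt₂)) = ⊥-elim (<-asym lt₁ lt₂)
    TreeEdge-prop (inj₂ (_ , lt₁)) (inj₁ (_ , lt₂)) = ⊥-elim (<-asym lt₁ lt₂)

    TreeEdge-sym : Symmetric TreeEdge
    TreeEdge-sym (inj₁ x) = inj₂ x
    TreeEdge-sym (inj₂ x) = inj₁ x

    ParentEdge⇒E : ∀ {a b} → ParentEdge a b → E a b
    ParentEdge⇒E (code≡ , lt) with code-inj code≡
    ... | refl = parent-adj (≤-<-trans z≤n lt)

    TreeEdge⇒E : ∀ {a b} → TreeEdge a b → E a b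
    TreeEdge⇒E (inj₁ x) = ParentEdge⇒E x
    TreeEdge⇒E (inj₂ x) = E-sym (ParentEdge⇒E x)

    TreeEdge⇒ParentEdge : ∀ {a b} → depth b ≤ depth a → TreeEdge a b → ParentEdge a b
    TreeEdge⇒ParentEdge _ (inj₁ x) = x
    TreeEdge⇒ParentEdge le (inj₂ (_ , lt)) = ⊥-elim (<⇒≱ lt le)

    path-to-root : ∀ v → Acc _<_ (depth v) → Star TreeEdge v root
    path-to-root v (acc below) with depth v in eq
    ... | zero = subst (λ x → Star TreeEdge x root) (sym (depth-zero eq)) ε
    ... | suc n = inj₁ (refl , lower) ◅ path-to-root (parent v) (below lower′)
      where
      lower : depth (parent v) < depth v
      lower = parent-depth (subst (0 <_) (sym eq) (s≤s z≤n))
      lower′ : depth (parent v) < suc n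
      lower′ = subst (depth (parent v) <_) eq lower

    TreeEdge-connected : ∀ u v → Star TreeEdge u v
    TreeEdge-connected u v =
      path-to-root u (<-wellFounded _) ◅◅ reverse TreeEdge-sym (path-to-root v (<-wellFounded _))

    TreeEdge-up-unique : ∀ {a b b′} → depth b ≤ depth a → depth b′ ≤ depth a →
                         TreeEdge a b → TreeEdge a b′ → b ≡ b′
    TreeEdge-up-unique le le′ a~b a~b′ = code-inj
      (trans (sym (proj₁ (TreeEdge⇒ParentEdge le a~b))) (proj₁ (TreeEdge⇒ParentEdge le′ a~b′)))

    -- A deepest vertex of a cycle would have both of its cycle neighbours as parent.
    deepest-not-on-cycle : (C : Cycle TreeEdge) → ∀ i →
                           (∀ j → depth (Cycle.c C j) ≤ depth (Cycle.c C i)) → ⊥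
    deepest-not-on-cycle C i deepest with cycle-neighbours TreeEdge-sym C i
    ... | j , k , j≢k , i~j , i~k =
      j≢k (Cycle.c-inj C (TreeEdge-up-unique (deepest j) (deepest k) i~j i~k))

    TreeEdge-acyclic : Acyclic TreeEdge
    TreeEdge-acyclic C =
      let i , deepest = maximum (depth ∘ Cycle.c C) in deepest-not-on-cycle C i deepest

    parentTree : SpanningTree G
    parentTree = record
      { T = TreeEdge ; T-prop = TreeEdge-prop ; T-sym = TreeEdge-sym ; T⊆E = TreeEdge⇒E
      ; T-conn = TreeEdge-connected ; T-acyc = TreeEdge-acyclic }

    module _ (R : Ray TreeEdge) where
      open Ray R

      Descends : ℕ → Set
      Descends n = ParentEdge (r (suc n)) (r n)

      descends-suc : ∀ {n} → Descends n → Descends (suc n)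
      descends-suc {n} descends with r-adj (suc n)
      ... | inj₂ descends′ = descends′
      ... | inj₁ (parent≡ , _) =
        ⊥-elim (m≢1+n+m n (sym (r-inj (code-inj (trans (sym parent≡) (proj₁ descends))))))

      descends-deep : ∀ {m} → Descends m → ∀ k → Descends (k + m) × k ≤ depth (r (k + m))
      descends-deep descends zero = descends , z≤n
      descends-deep descends (suc k) =
        let descends′ , deep = descends-deep descends k
        in descends-suc descends′ , ≤-<-trans deep (proj₂ descends′)

      eventually-descends : ∀ n → Acc _<_ (depth (r n)) → ∃ Descends
      eventually-descends n (acc below) with r-adj n
      ... | inj₁ (_ , lower) = eventually-descends (suc n) (below lower)
      ... | inj₂ descends = n , descends

    parentTree-rayFree : ∀ B → (∀ v → depth v ≤ B) → RayFree G parentTree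
    parentTree-rayFree B bounded R with eventually-descends R 0 (<-wellFounded _)
    ... | m , descends = n≮n B (≤-trans (proj₂ (descends-deep R descends (suc B))) (bounded _))

mainTheorem11 : ExcludedMiddle 0ℓ → (G : Graph) → Countable G → Connected G → Compact G →
    Σ (SpanningTree G) (RayFree G)
mainTheorem11 lem G (code , code-inj) (root , reach) compact =
  parentTree , parentTree-rayFree (suc B) depth-bounded
  where
  open BreadthFirst G lem root (λ v → reach v root)
  open ParentTree G code code-inj root depth parent depth-zero parent-adj parent-depth

  dominated : ∃ (DominatedBelow G code)
  dominated = compact⇒finitelyDominated G lem compact code

  dominators-bounded : ∃[ B ] (∀ {u} → code u < proj₁ dominated → depth u ≤ B)
  dominators-bounded = bounded-on-code< lem code code-inj depth (proj₁ dominated)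

  B : ℕ
  B = proj₁ dominators-bounded

  depth-bounded : ∀ w → depth w ≤ suc B
  depth-bounded w with proj₂ dominated w
  ... | u , code<n , u~w = ≤-trans (depth-N u~w) (s≤s (proj₂ dominators-bounded code<n))
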